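{- For every $n$ that is a multiple of $8$ there is a finite collection (multiset) of vectors $a_1,\dots,a_T\in\{\pm1\}^n$ and a signing $\varepsilon\in\{\pm1\}^T$ which is a local optimum for the $\ell_2$-potential (i.e., for every $i$, flipping $\varepsilon_i$ does not strictly decrease $\|\sum_j\varepsilon_ja_j\|_2^2$) and has discrepancy $\|\sum_j\varepsilon_ja_j\|_\infty=\Omega(2^{n/2})$, while the global optimum $\min_{\varepsilon'\in\{\pm1\}^T}\|\sum_j\varepsilon'_ja_j\|_\infty$ equals $0$. -}

module Defs where

open import Data.Nat using (ℕ; zero; suc; _⊔_)
open import Data.Fin using (Fin; zero; suc; _≟_)
open import Data.Integer using (ℤ; +_; -_; _+_; _*_; ∣_∣)
open import Relation.Nullary using (yes; no)

data Sign : Set where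
  plus minus : Sign

toℤ : Sign → ℤ
toℤ plus  = + 1
toℤ minus = - (+ 1)

neg : Sign → Sign
neg plus  = minus
neg minus = plus

∑ : ∀ {T} → (Fin T → ℤ) → ℤ
∑ {zero}  f = + 0
∑ {suc T} f = f zero + ∑ (λ j → f (suc j))

-- finite maximum over Fin n (empty max = 0; values are ≥ 0 anyway)
maxFin : ∀ {n} → (Fin n → ℕ) → ℕ
maxFin {zero}  f = 0
maxFin {suc n} f = f zero ⊔ maxFin (λ i → f (suc i))

signedSum : ∀ {n T} → (Fin T → Fin n → Sign) → (Fin T → Sign) → Fin n → ℤ
signedSum a ε i = ∑ (λ j → toℤ (ε j) * toℤ (a j i))

normSq : ∀ {n} → (Fin n → ℤ) → ℤ
normSq v = ∑ (λ i → v i * v i)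

normInf : ∀ {n} → (Fin n → ℤ) → ℕ
normInf v = maxFin (λ i → ∣ v i ∣)

flipAt : ∀ {T} → Fin T → (Fin T → Sign) → Fin T → Sign
flipAt i ε j with i ≟ j
... | yes _ = neg (ε j)
... | no  _ = ε j

{-# OPTIONS --safe #-}
module Submission where

-- Flipping ε_i changes ‖S‖², S = Σ ε_j a_j, by 4 (n − ε_i ⟨S, a_i⟩), so a signing is a local optimum
-- as soon as every ε_i ⟨S, a_i⟩ ≤ n. The example is built two coordinates at a time from a multiset H
-- with sum t such that ⟨t, h⟩ ≤ 4 for all h ∈ H, together with a sign vector r ⊥ t: the next multiset
-- consists of (−1, −1, h) for h in H ++ H and |H| + 1 copies each of (1, 1, ±r). Its sum is (2, 2, 2t),
-- so both invariants persist (with r′ = (1, −1, r)) while some coordinate of t doubles at every step.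
-- After K steps H ++ H, signed all plus, is a local optimum (⟨2t, h⟩ ≤ 8 ≤ n) of discrepancy ≥ 2^K,
-- whereas signing the two copies of H oppositely gives 0.

open import Defs

open import Data.Nat as ℕ using (ℕ; zero; suc; s≤s; z≤n)
import Data.Nat.Properties as ℕ
open import Data.Fin using (Fin; zero; suc; splitAt; _≟_)
open import Data.Fin.Properties using (suc-injective)
open import Data.Product using (Σ; _×_; _,_)
open import Data.Sum using (inj₁; inj₂)
open import Data.Sum.Properties using ([,]-∘)
open import Data.Vec.Functional using (Vector; _∷_; _++_; map; zipWith; replicate)
open import Data.Vec.Functional.Relation.Unary.All.Properties using (++⁺)
open import Function using (_∘_)
open import Relation.Binary.PropositionalEquality
open import Relation.Nullary using (¬_; yes; no)
open import Data.Empty using (⊥-elim)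

-- Integer notation is opened only inside this module, so that the statement of lemma4p1 reads with ℕ's.
module _ where

  open import Data.Integer as ℤ
    using (ℤ; +_; -_; _+_; _-_; _*_; _≤_; ∣_∣; 0ℤ; 1ℤ; -1ℤ; +≤+)
  open import Data.Integer.Properties
    using (+-identityˡ; +-identityʳ; +-assoc; *-identityˡ; *-identityʳ; *-zeroʳ;
           *-distribʳ-+; *-distribˡ-+; neg-distribʳ-*; neg-distrib-+; pos-+;
           ≤-reflexive; ≤⇒≯; +-monoʳ-≤; +-mono-≤; i≤j⇒0≤j-i; *-monoˡ-≤-nonNeg; module ≤-Reasoning)
  open import Data.Integer.Tactic.RingSolver using (solve-∀)

  private
    variable
      A B C : Set
      m n T : ℕ

  ∑-cong : {f g : Fin n → ℤ} → (∀ i → f i ≡ g i) → ∑ f ≡ ∑ g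
  ∑-cong {zero}  f≗g = refl
  ∑-cong {suc n} f≗g = cong₂ _+_ (f≗g zero) (∑-cong (f≗g ∘ suc))

  ∑-distrib-+ : (f g : Fin n → ℤ) → ∑ (λ i → f i + g i) ≡ ∑ f + ∑ g
  ∑-distrib-+ {zero}  f g = refl
  ∑-distrib-+ {suc n} f g = begin
    f zero + g zero + ∑ (λ i → f (suc i) + g (suc i))
      ≡⟨ cong (_+_ (f zero + g zero)) (∑-distrib-+ (f ∘ suc) (g ∘ suc)) ⟩
    f zero + g zero + (∑ (f ∘ suc) + ∑ (g ∘ suc))      ≡⟨ interchange (f zero) (g zero) _ _ ⟩
    f zero + ∑ (f ∘ suc) + (g zero + ∑ (g ∘ suc))      ∎
    where
      open ≡-Reasoning
      interchange : ∀ a b c d → a + b + (c + d) ≡ a + c + (b + d)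
      interchange = solve-∀

  ∑-distribˡ-* : (c : ℤ) (f : Fin n → ℤ) → ∑ (λ i → c * f i) ≡ c * ∑ f
  ∑-distribˡ-* {zero}  c f = sym (*-zeroʳ c)
  ∑-distribˡ-* {suc n} c f =
    trans (cong (_+_ (c * f zero)) (∑-distribˡ-* c (f ∘ suc))) (sym (*-distribˡ-+ c (f zero) _))

  ∑-neg : (f : Fin n → ℤ) → ∑ (λ i → - f i) ≡ - ∑ f
  ∑-neg {zero}  f = refl
  ∑-neg {suc n} f = trans (cong (_+_ (- f zero)) (∑-neg (f ∘ suc))) (sym (neg-distrib-+ (f zero) _))

  ∑-const : (c : ℤ) → ∑ {n} (λ _ → c) ≡ + n * c
  ∑-const {zero}  c = refl
  ∑-const {suc n} c = begin
    c + ∑ {n} (λ _ → c)  ≡⟨ cong₂ _+_ (sym (*-identityˡ c)) (∑-const {n} c) ⟩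
    1ℤ * c + + n * c     ≡⟨ *-distribʳ-+ c 1ℤ (+ n) ⟨
    + suc n * c          ∎
    where open ≡-Reasoning

  ∑-++ : (f : Vector ℤ m) (g : Vector ℤ n) → ∑ (f ++ g) ≡ ∑ f + ∑ g
  ∑-++ {zero}  f g = sym (+-identityˡ (∑ g))
  ∑-++ {suc m} f g = begin
    f zero + ∑ (λ i → (f ++ g) (suc i))  ≡⟨ cong (_+_ (f zero)) (∑-cong tail-++) ⟩
    f zero + ∑ ((f ∘ suc) ++ g)          ≡⟨ cong (_+_ (f zero)) (∑-++ (f ∘ suc) g) ⟩
    f zero + (∑ (f ∘ suc) + ∑ g)         ≡⟨ +-assoc (f zero) _ _ ⟨
    f zero + ∑ (f ∘ suc) + ∑ g           ∎
    where
      open ≡-Reasoning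
      tail-++ : ∀ i → (f ++ g) (suc i) ≡ ((f ∘ suc) ++ g) i
      tail-++ i with splitAt m i
      ... | inj₁ _ = refl
      ... | inj₂ _ = refl

  ∑-differAt : (f g : Fin n → ℤ) (i : Fin n) → (∀ j → i ≢ j → g j ≡ f j) →
               ∑ g + f i ≡ ∑ f + g i
  ∑-differAt {suc n} f g zero g≗f = begin
    g zero + ∑ (g ∘ suc) + f zero  ≡⟨ cong (λ s → g zero + s + f zero) (∑-cong (λ j → g≗f (suc j) λ ())) ⟩
    g zero + ∑ (f ∘ suc) + f zero  ≡⟨ rotate (g zero) _ (f zero) ⟩
    f zero + ∑ (f ∘ suc) + g zero  ∎
    where
      open ≡-Reasoning
      rotate : ∀ a b c → a + b + c ≡ c + b + a
      rotate = solve-∀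
  ∑-differAt {suc n} f g (suc i) g≗f = begin
    g zero + ∑ (g ∘ suc) + f (suc i)    ≡⟨ +-assoc (g zero) _ _ ⟩
    g zero + (∑ (g ∘ suc) + f (suc i))
      ≡⟨ cong₂ _+_ (g≗f zero λ ()) (∑-differAt (f ∘ suc) (g ∘ suc) i g≗f-tail) ⟩
    f zero + (∑ (f ∘ suc) + g (suc i))  ≡⟨ +-assoc (f zero) _ _ ⟨
    f zero + ∑ (f ∘ suc) + g (suc i)    ∎
    where
      open ≡-Reasoning
      g≗f-tail : ∀ j → i ≢ j → g (suc j) ≡ f (suc j)
      g≗f-tail j i≢j = g≗f (suc j) (i≢j ∘ suc-injective)

  map-++ : (f : A → B) (xs : Vector A m) (ys : Vector A n) →
           ∀ i → f ((xs ++ ys) i) ≡ (map f xs ++ map f ys) i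
  map-++ {m = m} f xs ys i = [,]-∘ f (splitAt m i)

  zipWith-++ : (f : A → B → C) (xs : Vector A m) (ys : Vector A n) (us : Vector B m) (vs : Vector B n) →
               ∀ i → f ((xs ++ ys) i) ((us ++ vs) i) ≡ (zipWith f xs us ++ zipWith f ys vs) i
  zipWith-++ {m = m} f xs ys us vs i with splitAt m i
  ... | inj₁ _ = refl
  ... | inj₂ _ = refl

  toℤ-neg : ∀ s → toℤ (neg s) ≡ - toℤ s
  toℤ-neg plus  = refl
  toℤ-neg minus = refl

  toℤ*toℤ≡1 : ∀ s → toℤ s * toℤ s ≡ 1ℤ
  toℤ*toℤ≡1 plus  = refl
  toℤ*toℤ≡1 minus = refl

  total : (Fin T → Fin n → Sign) → Fin n → ℤ
  total a x = ∑ (λ j → toℤ (a j x))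

  total-++ : (a : Fin m → Fin n → Sign) (b : Fin T → Fin n → Sign) →
             ∀ x → total (a ++ b) x ≡ total a x + total b x
  total-++ a b x =
    trans (∑-cong (map-++ (λ v → toℤ (v x)) a b)) (∑-++ (λ j → toℤ (a j x)) (λ j → toℤ (b j x)))

  signedSum-const : (a : Fin T → Fin n → Sign) (s : Sign) →
                    ∀ x → signedSum a (λ _ → s) x ≡ toℤ s * total a x
  signedSum-const a s x = ∑-distribˡ-* (toℤ s) (λ j → toℤ (a j x))

  signedSum-++ : (a : Fin m → Fin n → Sign) (b : Fin T → Fin n → Sign)
                 (ε : Fin m → Sign) (δ : Fin T → Sign) →
                 ∀ x → signedSum (a ++ b) (ε ++ δ) x ≡ signedSum a ε x + signedSum b δ x
  signedSum-++ a b ε δ x =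
    trans (∑-cong (zipWith-++ (λ s v → toℤ s * toℤ (v x)) ε δ a b))
          (∑-++ (λ j → toℤ (ε j) * toℤ (a j x)) (λ j → toℤ (δ j) * toℤ (b j x)))

  signedSum-doubled : (a : Fin T → Fin n → Sign) →
                      ∀ x → signedSum (a ++ a) (λ _ → plus) x ≡ total a x + total a x
  signedSum-doubled a x = trans (signedSum-const (a ++ a) plus x) (trans (*-identityˡ _) (total-++ a a x))

  signedSum-doubled-cancels : (a : Fin T → Fin n → Sign) →
                              ∀ x → signedSum (a ++ a) (replicate T plus ++ replicate T minus) x ≡ 0ℤ
  signedSum-doubled-cancels {T} a x = begin
    signedSum (a ++ a) (replicate T plus ++ replicate T minus) x  ≡⟨ signedSum-++ a a _ _ x ⟩
    signedSum a (λ _ → plus) x + signedSum a (λ _ → minus) x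
      ≡⟨ cong₂ _+_ (signedSum-const a plus x) (signedSum-const a minus x) ⟩
    1ℤ * total a x + -1ℤ * total a x                              ≡⟨ cancel (total a x) ⟩
    0ℤ                                                            ∎
    where
      open ≡-Reasoning
      cancel : ∀ z → 1ℤ * z + -1ℤ * z ≡ 0ℤ
      cancel = solve-∀

  infixl 7 _·_
  _·_ : (u v : Fin n → ℤ) → ℤ
  u · v = ∑ (λ x → u x * v x)

  ·-congˡ : {u u′ : Fin n → ℤ} (v : Fin n → ℤ) → (∀ x → u x ≡ u′ x) → u · v ≡ u′ · v
  ·-congˡ v u≗u′ = ∑-cong (λ x → cong (_* v x) (u≗u′ x))

  ·-distribʳ-+ : (u u′ v : Fin n → ℤ) → (λ x → u x + u′ x) · v ≡ u · v + u′ · v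
  ·-distribʳ-+ u u′ v =
    trans (∑-cong (λ x → *-distribʳ-+ (v x) (u x) (u′ x))) (∑-distrib-+ (λ x → u x * v x) (λ x → u′ x * v x))

  ·-neg : (u : Fin n → ℤ) (w : Fin n → Sign) → u · toℤ ∘ neg ∘ w ≡ - (u · toℤ ∘ w)
  ·-neg u w = trans (∑-cong (λ x → trans (cong (u x *_) (toℤ-neg (w x))) (sym (neg-distribʳ-* (u x) _))))
                    (∑-neg (λ x → u x * toℤ (w x)))

  flipAt-self : (i : Fin T) (ε : Fin T → Sign) → flipAt i ε i ≡ neg (ε i)
  flipAt-self i ε with i ≟ i
  ... | yes _   = refl
  ... | no i≢i = ⊥-elim (i≢i refl)

  flipAt-≢ : (i j : Fin T) (ε : Fin T → Sign) → i ≢ j → flipAt i ε j ≡ ε j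
  flipAt-≢ i j ε i≢j with i ≟ j
  ... | yes i≡j = ⊥-elim (i≢j i≡j)
  ... | no _    = refl

  signedSum-flipAt : (a : Fin T → Fin n → Sign) (ε : Fin T → Sign) (i : Fin T) →
                     ∀ x → signedSum a (flipAt i ε) x ≡
                           signedSum a ε x - + 2 * (toℤ (ε i) * toℤ (a i x))
  signedSum-flipAt a ε i x = begin
    ∑ g                     ≡⟨ cancel (∑ g) (f i) ⟨
    ∑ g + f i - f i
      ≡⟨ cong (_- f i) (∑-differAt f g i g≗f) ⟩
    ∑ f + g i - f i
      ≡⟨ cong (λ s → ∑ f + toℤ s * toℤ (a i x) - f i) (flipAt-self i ε) ⟩
    ∑ f + toℤ (neg (ε i)) * toℤ (a i x) - f i
      ≡⟨ cong (λ e → ∑ f + e * toℤ (a i x) - f i) (toℤ-neg (ε i)) ⟩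
    ∑ f + - toℤ (ε i) * toℤ (a i x) - f i
      ≡⟨ collect (∑ f) (toℤ (ε i)) (toℤ (a i x)) ⟩
    ∑ f - + 2 * f i         ∎
    where
      open ≡-Reasoning
      f g : Fin _ → ℤ
      f j = toℤ (ε j) * toℤ (a j x)
      g j = toℤ (flipAt i ε j) * toℤ (a j x)
      g≗f : ∀ j → i ≢ j → g j ≡ f j
      g≗f j i≢j = cong (λ s → toℤ s * toℤ (a j x)) (flipAt-≢ i j ε i≢j)
      cancel : ∀ s t → s + t - t ≡ s
      cancel = solve-∀
      collect : ∀ s e b → s + - e * b - e * b ≡ s - + 2 * (e * b)
      collect = solve-∀

  normSq-flipAt : (a : Fin T → Fin n → Sign) (ε : Fin T → Sign) (i : Fin T) →
                  normSq (signedSum a (flipAt i ε)) ≡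
                  normSq (signedSum a ε) + + 4 * (+ n - toℤ (ε i) * (signedSum a ε · toℤ ∘ a i))
  normSq-flipAt {n = n} a ε i = begin
    ∑ (λ x → w x * w x)                                   ≡⟨ ∑-cong square ⟩
    ∑ (λ x → v x * v x + + 4 * deficit x)                 ≡⟨ ∑-distrib-+ (λ x → v x * v x) (λ x → + 4 * deficit x) ⟩
    normSq v + ∑ (λ x → + 4 * deficit x)                  ≡⟨ cong (_+_ (normSq v)) (∑-distribˡ-* (+ 4) deficit) ⟩
    normSq v + + 4 * ∑ deficit                            ≡⟨ cong (λ s → normSq v + + 4 * s) ∑-deficit ⟩
    normSq v + + 4 * (+ n - e * (v · ai))                 ∎
    where
      open ≡-Reasoning
      v w ai : Fin n → ℤ
      v  = signedSum a ε
      w  = signedSum a (flipAt i ε)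
      ai = toℤ ∘ a i
      e : ℤ
      e = toℤ (ε i)
      deficit : Fin n → ℤ
      deficit x = 1ℤ - e * (v x * ai x)
      expand : ∀ v e b →
               (v - + 2 * (e * b)) * (v - + 2 * (e * b)) ≡ v * v + + 4 * ((e * e) * (b * b) - e * (v * b))
      expand = solve-∀
      square : ∀ x → w x * w x ≡ v x * v x + + 4 * deficit x
      square x = begin
        w x * w x                                            ≡⟨ cong (λ y → y * y) (signedSum-flipAt a ε i x) ⟩
        (v x - + 2 * (e * ai x)) * (v x - + 2 * (e * ai x))  ≡⟨ expand (v x) e (ai x) ⟩
        v x * v x + + 4 * ((e * e) * (ai x * ai x) - e * (v x * ai x))
          ≡⟨ cong₂ (λ p q → v x * v x + + 4 * (p * q - e * (v x * ai x))) (toℤ*toℤ≡1 (ε i)) (toℤ*toℤ≡1 (a i x)) ⟩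
        v x * v x + + 4 * deficit x                          ∎
      ∑-deficit : ∑ deficit ≡ + n - e * (v · ai)
      ∑-deficit = begin
        ∑ deficit                                        ≡⟨ ∑-distrib-+ (λ _ → 1ℤ) (λ x → - (e * (v x * ai x))) ⟩
        ∑ {n} (λ _ → 1ℤ) + ∑ (λ x → - (e * (v x * ai x)))
          ≡⟨ cong₂ _+_ (trans (∑-const {n} 1ℤ) (*-identityʳ (+ n))) (∑-neg (λ x → e * (v x * ai x))) ⟩
        + n - ∑ (λ x → e * (v x * ai x))                 ≡⟨ cong (λ s → + n - s) (∑-distribˡ-* e (λ x → v x * ai x)) ⟩
        + n - e * (v · ai)                               ∎

  LocallyOptimal : (a : Fin T → Fin n → Sign) (ε : Fin T → Sign) → Set
  LocallyOptimal a ε = ∀ i → ¬ (normSq (signedSum a (flipAt i ε)) ℤ.< normSq (signedSum a ε))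

  locallyOptimal : (a : Fin T → Fin n → Sign) (ε : Fin T → Sign) →
                   (∀ i → toℤ (ε i) * (signedSum a ε · toℤ ∘ a i) ≤ + n) → LocallyOptimal a ε
  locallyOptimal {n = n} a ε small i = ≤⇒≯ (begin
    normSq v                  ≡⟨ +-identityʳ (normSq v) ⟨
    normSq v + 0ℤ
      ≤⟨ +-monoʳ-≤ (normSq v) (*-monoˡ-≤-nonNeg (+ 4) (i≤j⇒0≤j-i (small i))) ⟩
    normSq v + + 4 * (+ n - toℤ (ε i) * (v · toℤ ∘ a i))
      ≡⟨ normSq-flipAt a ε i ⟨
    normSq (signedSum a (flipAt i ε)) ∎)
    where
      open ≤-Reasoning
      v : Fin n → ℤ
      v = signedSum a ε

  ≤maxFin : (f : Fin n → ℕ) (i : Fin n) → f i ℕ.≤ maxFin f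
  ≤maxFin f zero    = ℕ.m≤m⊔n (f zero) _
  ≤maxFin f (suc i) = ℕ.≤-trans (≤maxFin (f ∘ suc) i) (ℕ.m≤n⊔m (f zero) _)

  maxFin-zero : (f : Fin n → ℕ) → (∀ i → f i ≡ 0) → maxFin f ≡ 0
  maxFin-zero {zero}  f f≗0 = refl
  maxFin-zero {suc n} f f≗0 = cong₂ ℕ._⊔_ (f≗0 zero) (maxFin-zero (f ∘ suc) (f≗0 ∘ suc))

  -- Stands for the multiset half ++ half, whose all-plus sum is 2 · total half.
  record Gadget (n : ℕ) : Set where
    field
      size         : ℕ
      half         : Fin size → Fin n → Sign
      r            : Fin n → Sign
      total·half≤4 : ∀ j → total half · toℤ ∘ half j ≤ + 4
      total·r≡0    : total half · toℤ ∘ r ≡ 0ℤ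

  emptyGadget : Gadget 0
  emptyGadget = record { size = 0 ; half = λ () ; r = λ () ; total·half≤4 = λ () ; total·r≡0 = refl }

  module Step {n : ℕ} (G : Gadget n) where
    open Gadget G

    t : Fin n → ℤ
    t = total half

    extend : (Fin n → Sign) → Fin (2 ℕ.+ n) → Sign
    extend v = minus ∷ minus ∷ v

    lifted : Fin (size ℕ.+ size) → Fin (2 ℕ.+ n) → Sign
    lifted = map extend (half ++ half)

    up down : Fin (suc size) → Fin (2 ℕ.+ n) → Sign
    up   = replicate (suc size) (plus ∷ plus ∷ r)
    down = replicate (suc size) (plus ∷ plus ∷ neg ∘ r)

    half′ : Fin ((size ℕ.+ size) ℕ.+ (suc size ℕ.+ suc size)) → Fin (2 ℕ.+ n) → Sign
    half′ = lifted ++ (up ++ down)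

    r′ : Fin (2 ℕ.+ n) → Sign
    r′ = plus ∷ minus ∷ r

    t′ : Fin (2 ℕ.+ n) → ℤ
    t′ = total half′

    t′-split : ∀ x → t′ x ≡ total lifted x + (total up x + total down x)
    t′-split x = trans (total-++ lifted (up ++ down) x) (cong (_+_ (total lifted x)) (total-++ up down x))

    newCoordinate≡2 :
      ∑ {size ℕ.+ size} (λ _ → -1ℤ) + (∑ {suc size} (λ _ → 1ℤ) + ∑ {suc size} (λ _ → 1ℤ)) ≡ + 2
    newCoordinate≡2 = begin
      ∑ {size ℕ.+ size} (λ _ → -1ℤ) + (∑ {suc size} (λ _ → 1ℤ) + ∑ {suc size} (λ _ → 1ℤ))
        ≡⟨ cong₂ _+_ (∑-const {size ℕ.+ size} -1ℤ)
                     (cong₂ _+_ (∑-const {suc size} 1ℤ) (∑-const {suc size} 1ℤ)) ⟩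
      + (size ℕ.+ size) * -1ℤ + (+ suc size * 1ℤ + + suc size * 1ℤ)
        ≡⟨ cong (λ z → z * -1ℤ + (+ suc size * 1ℤ + + suc size * 1ℤ)) (pos-+ size size) ⟩
      (+ size + + size) * -1ℤ + ((1ℤ + + size) * 1ℤ + (1ℤ + + size) * 1ℤ)
        ≡⟨ balance (+ size) ⟩
      + 2 ∎
      where
        open ≡-Reasoning
        balance : ∀ z → (z + z) * -1ℤ + ((1ℤ + z) * 1ℤ + (1ℤ + z) * 1ℤ) ≡ + 2
        balance = solve-∀

    t′-0 : t′ zero ≡ + 2
    t′-0 = trans (t′-split zero) newCoordinate≡2

    t′-1 : t′ (suc zero) ≡ + 2
    t′-1 = trans (t′-split (suc zero)) newCoordinate≡2

    t′-tail : ∀ y → t′ (suc (suc y)) ≡ t y + t y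
    t′-tail y = begin
      t′ (suc (suc y))                                   ≡⟨ t′-split (suc (suc y)) ⟩
      total (half ++ half) y + (total up (suc (suc y)) + total down (suc (suc y)))
        ≡⟨ cong₂ _+_ (total-++ half half y) up+down≡0 ⟩
      t y + t y + 0ℤ                                     ≡⟨ +-identityʳ _ ⟩
      t y + t y                                          ∎
      where
        open ≡-Reasoning
        cancel : ∀ z w → z * w + z * - w ≡ 0ℤ
        cancel = solve-∀
        up+down≡0 : ∑ {suc size} (λ _ → toℤ (r y)) + ∑ {suc size} (λ _ → toℤ (neg (r y))) ≡ 0ℤ
        up+down≡0 = begin
          ∑ {suc size} (λ _ → toℤ (r y)) + ∑ {suc size} (λ _ → toℤ (neg (r y)))
            ≡⟨ cong₂ _+_ (∑-const {suc size} (toℤ (r y))) (∑-const {suc size} (toℤ (neg (r y)))) ⟩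
          + suc size * toℤ (r y) + + suc size * toℤ (neg (r y))
            ≡⟨ cong (λ s → + suc size * toℤ (r y) + + suc size * s) (toℤ-neg (r y)) ⟩
          + suc size * toℤ (r y) + + suc size * - toℤ (r y)  ≡⟨ cancel (+ suc size) (toℤ (r y)) ⟩
          0ℤ ∎

    t′·∷∷ : ∀ s s′ w →
            t′ · toℤ ∘ (s ∷ s′ ∷ w) ≡ + 2 * toℤ s + (+ 2 * toℤ s′ + (t · toℤ ∘ w + t · toℤ ∘ w))
    t′·∷∷ s s′ w = cong₂ _+_ (cong (_* toℤ s) t′-0) (cong₂ _+_ (cong (_* toℤ s′) t′-1)
      (trans (·-congˡ (toℤ ∘ w) t′-tail) (·-distribʳ-+ t t (toℤ ∘ w))))

    t′·extend≤4 : ∀ v → t · toℤ ∘ v ≤ + 4 → t′ · toℤ ∘ extend v ≤ + 4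
    t′·extend≤4 v t·v≤4 = begin
      t′ · toℤ ∘ extend v                            ≡⟨ t′·∷∷ minus minus v ⟩
      - + 2 + (- + 2 + (t · toℤ ∘ v + t · toℤ ∘ v))
        ≤⟨ +-monoʳ-≤ (- + 2) (+-monoʳ-≤ (- + 2) (+-mono-≤ t·v≤4 t·v≤4)) ⟩
      + 4                                            ∎
      where open ≤-Reasoning

    t′·up≡4 : t′ · toℤ ∘ (plus ∷ plus ∷ r) ≡ + 4
    t′·up≡4 = trans (t′·∷∷ plus plus r) (cong (λ d → + 2 + (+ 2 + (d + d))) total·r≡0)

    t′·down≡4 : t′ · toℤ ∘ (plus ∷ plus ∷ neg ∘ r) ≡ + 4
    t′·down≡4 = trans (t′·∷∷ plus plus (neg ∘ r))
                      (cong (λ d → + 2 + (+ 2 + (d + d))) (trans (·-neg t r) (cong -_ total·r≡0)))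

    t′·r′≡0 : t′ · toℤ ∘ r′ ≡ 0ℤ
    t′·r′≡0 = trans (t′·∷∷ plus minus r) (cong (λ d → + 2 + (- + 2 + (d + d))) total·r≡0)

    t′·half′≤4 : ∀ j → t′ · toℤ ∘ half′ j ≤ + 4
    t′·half′≤4 =
      ++⁺ Bounded′ {xs = lifted} {ys = up ++ down} lifted-bounded
          (++⁺ Bounded′ {xs = up} {ys = down} (λ _ → ≤-reflexive t′·up≡4) (λ _ → ≤-reflexive t′·down≡4))
      where
        Bounded : (Fin n → Sign) → Set
        Bounded v = t · toℤ ∘ v ≤ + 4
        Bounded′ : (Fin (2 ℕ.+ n) → Sign) → Set
        Bounded′ v = t′ · toℤ ∘ v ≤ + 4
        lifted-bounded : ∀ j → Bounded′ (lifted j)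
        lifted-bounded j =
          t′·extend≤4 ((half ++ half) j) (++⁺ Bounded {xs = half} {ys = half} total·half≤4 total·half≤4 j)

  step : Gadget n → Gadget (2 ℕ.+ n)
  step G = record
    { size         = _
    ; half         = half′
    ; r            = r′
    ; total·half≤4 = t′·half′≤4
    ; total·r≡0    = t′·r′≡0
    }
    where open Step G

  -- K * 2 rather than 2 * K: suc K * 2 reduces to 2 + K * 2, the dimension produced by step.
  tower : (K : ℕ) → Gadget (K ℕ.* 2)
  tower zero    = emptyGadget
  tower (suc K) = step (tower K)

  tower-peak : ∀ K → Σ (Fin (suc K ℕ.* 2)) λ x →
                     total (Gadget.half (tower (suc K))) x ≡ + 2 ℕ.^ suc K
  tower-peak zero    = zero , Step.t′-0 emptyGadget
  tower-peak (suc K) with tower-peak K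
  ... | x , tx≡2^K = suc (suc x) , (begin
    total half′ (suc (suc x))       ≡⟨ t′-tail x ⟩
    t x + t x                       ≡⟨ cong₂ _+_ tx≡2^K tx≡2^K ⟩
    + 2 ℕ.^ suc K + + 2 ℕ.^ suc K   ≡⟨ pos-+ (2 ℕ.^ suc K) _ ⟨
    + (2 ℕ.^ suc K ℕ.+ 2 ℕ.^ suc K) ≡⟨ cong (λ m → + (2 ℕ.^ suc K ℕ.+ m)) (ℕ.+-identityʳ _) ⟨
    + 2 ℕ.^ suc (suc K)             ∎)
    where
      open ≡-Reasoning
      open Step (tower (suc K))

  BadLocalOptimum : ℕ → ℕ → Set
  BadLocalOptimum n B = Σ ℕ λ T → Σ (Fin T → Fin n → Sign) λ a → Σ (Fin T → Sign) λ ε →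
    LocallyOptimal a ε × B ℕ.≤ normInf (signedSum a ε) ×
    Σ (Fin T → Sign) λ ε′ → normInf (signedSum a ε′) ≡ 0

  gadget⇒badLocalOptimum : {B : ℕ} (G : Gadget n) → 8 ℕ.≤ n →
                           (x : Fin n) → total (Gadget.half G) x ≡ + B → BadLocalOptimum n B
  gadget⇒badLocalOptimum {n} {B} G 8≤n x tx≡B =
    size ℕ.+ size , a , (λ _ → plus) , locallyOptimal a (λ _ → plus) aligned , large ,
    (replicate size plus ++ replicate size minus) ,
    maxFin-zero _ (λ y → cong ∣_∣ (signedSum-doubled-cancels half y))
    where
      open Gadget G
      t S : Fin n → ℤ
      t = total half
      a = half ++ half
      S = signedSum a (λ _ → plus)

      aligned : ∀ i → toℤ plus * (S · toℤ ∘ a i) ≤ + n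
      aligned i = begin
        toℤ plus * (S · toℤ ∘ a i)     ≡⟨ *-identityˡ _ ⟩
        S · toℤ ∘ a i                  ≡⟨ ·-congˡ (toℤ ∘ a i) (signedSum-doubled half) ⟩
        (λ y → t y + t y) · toℤ ∘ a i  ≡⟨ ·-distribʳ-+ t t (toℤ ∘ a i) ⟩
        t · toℤ ∘ a i + t · toℤ ∘ a i  ≤⟨ +-mono-≤ t·ai≤4 t·ai≤4 ⟩
        + 8                            ≤⟨ +≤+ 8≤n ⟩
        + n                            ∎
        where
          open ≤-Reasoning
          t·ai≤4 : t · toℤ ∘ a i ≤ + 4
          t·ai≤4 = ++⁺ (λ v → t · toℤ ∘ v ≤ + 4) {xs = half} {ys = half} total·half≤4 total·half≤4 i

      large : B ℕ.≤ normInf S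
      large = ℕ.≤-trans (subst (λ z → B ℕ.≤ ∣ z ∣) (sym S≡B+B) (ℕ.m≤m+n B B))
                        (≤maxFin (λ y → ∣ S y ∣) x)
        where
          S≡B+B : S x ≡ + B + + B
          S≡B+B = trans (signedSum-doubled half x) (cong₂ _+_ tx≡B tx≡B)

  badLocalOptimum : ∀ k → BadLocalOptimum (8 ℕ.* suc k) (2 ℕ.^ (4 ℕ.* suc k))
  badLocalOptimum k with tower-peak (k ℕ.+ 3 ℕ.* suc k)   -- 4 * suc k reduces to suc (k + 3 * suc k)
  ... | x , tx≡2^4k = subst (λ n → BadLocalOptimum n (2 ℕ.^ (4 ℕ.* suc k))) dim≡
                        (gadget⇒badLocalOptimum (tower (4 ℕ.* suc k)) 8≤dim x tx≡2^4k)
    where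
      dim≡ : 4 ℕ.* suc k ℕ.* 2 ≡ 8 ℕ.* suc k
      dim≡ = trans (ℕ.*-comm (4 ℕ.* suc k) 2) (sym (ℕ.*-assoc 2 4 (suc k)))
      8≤dim : 8 ℕ.≤ 4 ℕ.* suc k ℕ.* 2
      8≤dim = subst (8 ℕ.≤_) (sym dim≡) (ℕ.m≤m*n 8 (suc k))

open import Data.Nat using (_*_; _^_; _≤_; _<_)
import Data.Integer as ℤ

lemma4p1 : Σ ℕ λ p → Σ ℕ λ q → (0 < p) × (0 < q) × (Σ ℕ λ N → (k : ℕ) → N ≤ k →
    Σ ℕ λ T → Σ (Fin T → Fin (8 * k) → Sign) λ a → Σ (Fin T → Sign) λ ε →
      ((i : Fin T) → ¬ (normSq (signedSum a (flipAt i ε)) ℤ.< normSq (signedSum a ε)))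
      × (p * 2 ^ (4 * k) ≤ q * normInf (signedSum a ε))
      × (Σ (Fin T → Sign) λ ε′ → normInf (signedSum a ε′) ≡ 0))
lemma4p1 = 1 , 1 , s≤s z≤n , s≤s z≤n , 1 , λ where
  (suc k) _ → let T , a , ε , optimal , large , balanced = badLocalOptimum k
              in T , a , ε , optimal ,
                 subst₂ _≤_ (sym (ℕ.*-identityˡ _)) (sym (ℕ.*-identityˡ _)) large , balanced
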